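{- Let $\mathbb{F}$ be a (finite) field and $k$ a positive integer. Suppose there exists a set of $k$ mutually orthogoval $\mathrm{AG}(m,\mathbb{F})$ and a set of $k$ mutually orthogoval $\mathrm{AG}(n,\mathbb{F})$. Then there exists a set of $k$ mutually orthogoval $\mathrm{AG}(m+n,\mathbb{F})$.
   Context: $\mathrm{AG}(d,\mathbb{F})$ is the $d$-dimensional affine space over $\mathbb{F}$. A pair of spaces, both projective or both affine, of the same dimension and order and on the same point set (two incidence structures on a common point set, each isomorphic to the given space) are orthogoval if each line of one space intersects each line of the other space in at most two points. A set of spaces on a common point set is mutually orthogoval if every two distinct members are orthogoval. -}

module Defs where

open import Level using (0ℓ)
open import Data.Nat using (ℕ)
open import Data.Fin using (Fin)
open import Data.Vec using (Vec; zipWith; map; replicate)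
open import Data.Product using (Σ; ∃; _×_; _,_)
open import Function.Bundles using (_↔_; Inverse)
open import Relation.Binary.PropositionalEquality using (_≡_)
open import Relation.Nullary using (¬_)
import Data.Empty
open import Algebra.Structures using (IsCommutativeRing)

record Field : Set₁ where
  infixl 6 _+_
  infixl 7 _*_
  field
    Carrier : Set
    _+_ _*_ : Carrier → Carrier → Carrier
    -_ : Carrier → Carrier
    0# 1# : Carrier
    isCommutativeRing : IsCommutativeRing _≡_ _+_ _*_ -_ 0# 1#
    0≢1 : ¬ (0# ≡ 1#)
    inverse : ∀ x → ¬ (x ≡ 0#) → ∃ λ y → x * y ≡ 1#

IsFinite : Field → Set
IsFinite F = ∃ λ q → Field.Carrier F ↔ Fin q

module _ (F : Field) where
  open Field F

  Pt : ℕ → Set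
  Pt d = Vec Carrier d

  _⊕_ : ∀ {d} → Pt d → Pt d → Pt d
  _⊕_ = zipWith _+_

  _·_ : ∀ {d} → Carrier → Pt d → Pt d
  t · v = map (t *_) v

  NonZeroVec : ∀ {d} → Pt d → Set
  NonZeroVec v = ¬ (v ≡ replicate _ 0#)

  OnLine : ∀ {d} → Pt d → Pt d → Pt d → Set
  OnLine a v x = ∃ λ t → x ≡ a ⊕ (t · v)

  -- A copy of AG(d,F) on the point set P: the incidence structure whose
  -- lines are the preimages of the lines of AG(d,F) under a bijection
  -- P ↔ F^d (i.e. an incidence structure on P isomorphic to AG(d,F)).
  AGSpace : ℕ → Set → Set
  AGSpace d P = P ↔ Pt d

  module _ {d : ℕ} {P : Set} where
    OnLineOf : AGSpace d P → Pt d → Pt d → P → Set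
    OnLineOf S a v x = OnLine a v (Inverse.to S x)

    Orthogoval : AGSpace d P → AGSpace d P → Set
    Orthogoval S T =
      ∀ (a v b w : Pt d) → NonZeroVec v → NonZeroVec w →
      ∀ (x y z : P) → ¬ (x ≡ y) → ¬ (x ≡ z) → ¬ (y ≡ z) →
      OnLineOf S a v x → OnLineOf S a v y → OnLineOf S a v z →
      OnLineOf T b w x → OnLineOf T b w y → OnLineOf T b w z → Data.Empty.⊥

    LinesIncluded : AGSpace d P → AGSpace d P → Set
    LinesIncluded S T =
      ∀ (a v : Pt d) → NonZeroVec v →
      Σ (Pt d) λ b → Σ (Pt d) λ w → NonZeroVec w ×
        (∀ x → (OnLineOf S a v x → OnLineOf T b w x) × (OnLineOf T b w x → OnLineOf S a v x))

    SameSpace : AGSpace d P → AGSpace d P → Set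
    SameSpace S T = LinesIncluded S T × LinesIncluded T S

  MutuallyOrthogovalSet : (k d : ℕ) → Set₁
  MutuallyOrthogovalSet k d =
    Σ Set λ P → Σ (Fin k → AGSpace d P) λ S →
      (∀ i j → ¬ (i ≡ j) → ¬ SameSpace (S i) (S j) × Orthogoval (S i) (S j))

{-# OPTIONS --safe #-}
module Submission where

-- The direct product of two copies of affine geometry, S ⊗ T on P × Q with
-- coordinates concatenated, is a copy of AG(m + n, F); the i-th member of the
-- new family is S i ⊗ T i.  A line of S ⊗ T with direction (v₁, v₂) is either
-- vertical (v₁ = 0), lying in a fibre {x} × Q and mapped by the second
-- projection onto a line of T, or transversal (v₁ ≠ 0), mapped injectively by
-- the first projection onto a line of S.  Two vertical lines meeting in three
-- points give three common points of lines of T i and T j, two transversal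
-- ones three common points of lines of S i and S j, and a vertical and a
-- transversal line meet at most once.  Distinctness is inherited because the
-- lines ℓ × {y} of S ⊗ T recover the lines ℓ of S.

open import Defs
open import Data.Nat using (ℕ; zero; suc; _+_; _≥_)
open import Data.Fin.Properties using (inj⇒≟)
open import Data.Vec using ([]; _∷_; _++_; replicate; splitAt; take; drop)
open import Data.Vec.Properties
  using (≡-dec; ∷-injective; ++-injective; ++-injectiveˡ; map-++; zipWith-++; take++drop≡id)
open import Data.Product using (Σ; _×_; _,_; proj₁; proj₂)
open import Function using (_∘_)
open import Function.Bundles using (_↔_; Inverse; Injection; mk↔ₛ′)
open import Function.Properties.Inverse using (↔⇒↣)
open import Relation.Binary.PropositionalEquality
open import Relation.Binary.Definitions using (DecidableEquality)
open import Relation.Nullary using (¬_; yes; no)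
open import Data.Empty using (⊥; ⊥-elim)
open import Algebra.Bundles using (CommutativeRing)
open import Algebra.Definitions using (AlmostRightCancellative)
open import Algebra.Structures using (IsCommutativeRing)
import Algebra.Properties.Group as GroupProperties

open Inverse using (to; from; strictlyInverseˡ; strictlyInverseʳ)

replicate-++ : ∀ {a} {A : Set a} m n (x : A) →
  replicate (m + n) x ≡ replicate m x ++ replicate n x
replicate-++ zero    n x = refl
replicate-++ (suc m) n x = cong (x ∷_) (replicate-++ m n x)

to-injective : ∀ {A B : Set} (f : A ↔ B) {x y} → to f x ≡ to f y → x ≡ y
to-injective f = Injection.injective (↔⇒↣ f)

module _ (F : Field) where
  open Field F renaming (_+_ to _+ᶠ_)
  open IsCommutativeRing isCommutativeRing using (+-identityʳ; zeroʳ; *-assoc; *-identityʳ)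

  commutativeRing : CommutativeRing _ _
  commutativeRing = record { isCommutativeRing = isCommutativeRing }

  open GroupProperties (CommutativeRing.+-group commutativeRing) using (∙-cancelˡ)

  *-almostCancelʳ : AlmostRightCancellative _≡_ 0# _*_
  *-almostCancelʳ u s t u≢0 su≡tu with inverse u u≢0
  ... | u⁻¹ , uu⁻¹≡1 = begin
    s               ≡⟨ *-identityʳ s ⟨
    s * 1#          ≡⟨ cong (s *_) uu⁻¹≡1 ⟨
    s * (u * u⁻¹)   ≡⟨ *-assoc s u u⁻¹ ⟨
    (s * u) * u⁻¹   ≡⟨ cong (_* u⁻¹) su≡tu ⟩
    (t * u) * u⁻¹   ≡⟨ *-assoc t u u⁻¹ ⟩
    t * (u * u⁻¹)   ≡⟨ cong (t *_) uu⁻¹≡1 ⟩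
    t * 1#          ≡⟨ *-identityʳ t ⟩
    t               ∎
    where open ≡-Reasoning

  0v : ∀ d → Pt F d
  0v d = replicate d 0#

  lineAt : ∀ {d} → Pt F d → Pt F d → Carrier → Pt F d
  lineAt a v t = _⊕_ F a (_·_ F t v)

  lineAt-0v : ∀ {d} (a : Pt F d) t → lineAt a (0v d) t ≡ a
  lineAt-0v []      t = refl
  lineAt-0v (x ∷ a) t = cong₂ _∷_ (trans (cong (x +ᶠ_) (zeroʳ t)) (+-identityʳ x)) (lineAt-0v a t)

  lineAt-++ : ∀ {m n} (a₁ v₁ : Pt F m) (a₂ v₂ : Pt F n) t →
    lineAt (a₁ ++ a₂) (v₁ ++ v₂) t ≡ lineAt a₁ v₁ t ++ lineAt a₂ v₂ t
  lineAt-++ a₁ v₁ a₂ v₂ t =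
    trans (cong (_⊕_ F (a₁ ++ a₂)) (map-++ (t *_) v₁ v₂))
          (zipWith-++ _+ᶠ_ a₁ a₂ (_·_ F t v₁) (_·_ F t v₂))

  private variable
    m n : ℕ
    P Q : Set

  -- LinesIncluded F S T is by definition ∀ a v → NonZeroVec F v → IsLineOf T S a v.
  IsLineOf : ∀ {d} {R : Set} → AGSpace F d R → AGSpace F d R → Pt F d → Pt F d → Set
  IsLineOf {d} T S a v = Σ (Pt F d) λ b → Σ (Pt F d) λ w → NonZeroVec F w ×
    (∀ x → (OnLineOf F S a v x → OnLineOf F T b w x) × (OnLineOf F T b w x → OnLineOf F S a v x))

  _⊗_ : AGSpace F m P → AGSpace F n Q → AGSpace F (m + n) (P × Q)
  _⊗_ {m} S T = mk↔ₛ′ (λ p → to S (proj₁ p) ++ to T (proj₂ p))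
                      (λ u → from S (take m u) , from T (drop m u))
                      to∘from from∘to
    where
    to∘from : ∀ u → to S (from S (take m u)) ++ to T (from T (drop m u)) ≡ u
    to∘from u = trans (cong₂ _++_ (strictlyInverseˡ S _) (strictlyInverseˡ T _)) (take++drop≡id m u)

    from∘to : ∀ p → (from S (take m (to S (proj₁ p) ++ to T (proj₂ p))) ,
                     from T (drop m (to S (proj₁ p) ++ to T (proj₂ p)))) ≡ p
    from∘to (x , y) with ++-injective _ (to S x) (take++drop≡id m (to S x ++ to T y))
    ... | take≡ , drop≡ = cong₂ _,_ (trans (cong (from S) take≡) (strictlyInverseʳ S x))
                                    (trans (cong (from T) drop≡) (strictlyInverseʳ T y))

  onLineOf-from : ∀ {d} {R : Set} (S : AGSpace F d R) a v t →
    OnLineOf F S a v (from S (lineAt a v t))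
  onLineOf-from S a v t = t , strictlyInverseˡ S _

  module _ (S : AGSpace F m P) (T : AGSpace F n Q) where

    -- A record, unlike OnLineOf F (S ⊗ T) (a₁ ++ a₂) (v₁ ++ v₂) p, lets Agda infer the factor lines.
    record OnProductLine (a₁ v₁ : Pt F m) (a₂ v₂ : Pt F n) (p : P × Q) : Set where
      constructor onProductLine
      field
        param   : Carrier
        onLine₁ : to S (proj₁ p) ≡ lineAt a₁ v₁ param
        onLine₂ : to T (proj₂ p) ≡ lineAt a₂ v₂ param

    onLineOf⇒onProductLine : ∀ a₁ v₁ a₂ v₂ {p} →
      OnLineOf F (S ⊗ T) (a₁ ++ a₂) (v₁ ++ v₂) p → OnProductLine a₁ v₁ a₂ v₂ p
    onLineOf⇒onProductLine a₁ v₁ a₂ v₂ (t , eq)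
      with ++-injective _ _ (trans eq (lineAt-++ a₁ v₁ a₂ v₂ t))
    ... | eq₁ , eq₂ = onProductLine t eq₁ eq₂

    onProductLine⇒onLineOf : ∀ {a₁ v₁ a₂ v₂ p} →
      OnProductLine a₁ v₁ a₂ v₂ p → OnLineOf F (S ⊗ T) (a₁ ++ a₂) (v₁ ++ v₂) p
    onProductLine⇒onLineOf {a₁} {v₁} {a₂} {v₂} (onProductLine t eq₁ eq₂) =
      t , trans (cong₂ _++_ eq₁ eq₂) (sym (lineAt-++ a₁ v₁ a₂ v₂ t))

    onProductLine-proj₁ : ∀ {a₁ v₁ a₂ v₂ p} →
      OnProductLine a₁ v₁ a₂ v₂ p → OnLineOf F S a₁ v₁ (proj₁ p)
    onProductLine-proj₁ (onProductLine t eq₁ _) = t , eq₁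

    onProductLine-proj₂ : ∀ {a₁ v₁ a₂ v₂ p} →
      OnProductLine a₁ v₁ a₂ v₂ p → OnLineOf F T a₂ v₂ (proj₂ p)
    onProductLine-proj₂ (onProductLine t _ eq₂) = t , eq₂

    proj₁-constantOnVertical : ∀ {a₁ a₂ v₂ p q} →
      OnProductLine a₁ (0v m) a₂ v₂ p → OnProductLine a₁ (0v m) a₂ v₂ q → proj₁ p ≡ proj₁ q
    proj₁-constantOnVertical {a₁} (onProductLine t eqₚ _) (onProductLine s eq_q _) =
      to-injective S (trans (trans eqₚ (lineAt-0v a₁ t)) (sym (trans eq_q (lineAt-0v a₁ s))))

    proj₂-injectiveOnVertical : ∀ {a₁ a₂ v₂ p q} →
      OnProductLine a₁ (0v m) a₂ v₂ p → OnProductLine a₁ (0v m) a₂ v₂ q → proj₂ p ≡ proj₂ q → p ≡ q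
    proj₂-injectiveOnVertical pL qL = cong₂ _,_ (proj₁-constantOnVertical pL qL)

  data ProductDirection {m n} : Pt F m → Pt F n → Set where
    vertical    : ∀ {v₂} → NonZeroVec F v₂ → ProductDirection (0v m) v₂
    transversal : ∀ {v₁ v₂} → NonZeroVec F v₁ → ProductDirection v₁ v₂

  module _ (_≟_ : DecidableEquality Carrier) where

    lineAt-injective : ∀ {d} (a v : Pt F d) {s t} →
      NonZeroVec F v → lineAt a v s ≡ lineAt a v t → s ≡ t
    lineAt-injective []      []      v≢0 _  = ⊥-elim (v≢0 refl)
    lineAt-injective (x ∷ a) (y ∷ v) v≢0 eq with y ≟ 0# | ∷-injective eq
    ... | no y≢0   | head≡ , _ = *-almostCancelʳ y _ _ y≢0 (∙-cancelˡ x _ _ head≡)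
    ... | yes refl | _ , tail≡ = lineAt-injective a v (v≢0 ∘ cong (0# ∷_)) tail≡

    productDirection : (v₁ : Pt F m) (v₂ : Pt F n) →
      NonZeroVec F (v₁ ++ v₂) → ProductDirection v₁ v₂
    productDirection {m} {n} v₁ v₂ v≢0 with ≡-dec _≟_ v₁ (0v m)
    ... | yes refl = vertical λ v₂≡0 →
      v≢0 (trans (cong (0v m ++_) v₂≡0) (sym (replicate-++ m n 0#)))
    ... | no v₁≢0  = transversal v₁≢0

    proj₁-injectiveOnTransversal : (S : AGSpace F m P) (T : AGSpace F n Q) →
      ∀ {a₁ v₁ a₂ v₂ p q} → NonZeroVec F v₁ →
      OnProductLine S T a₁ v₁ a₂ v₂ p → OnProductLine S T a₁ v₁ a₂ v₂ q → proj₁ p ≡ proj₁ q → p ≡ q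
    proj₁-injectiveOnTransversal S T {a₁} {v₁} {p = x , y} {.x , y′} v₁≢0
      (onProductLine t x≡ y≡) (onProductLine s x≡′ y′≡) refl
      with lineAt-injective a₁ v₁ v₁≢0 (trans (sym x≡) x≡′)
    ... | refl = cong (x ,_) (to-injective T (trans y≡ (sym y′≡)))

    vertical∩transversal : (S S′ : AGSpace F m P) (T T′ : AGSpace F n Q) →
      ∀ {a₁ a₂ v₂ b₁ w₁ b₂ w₂ p q} → NonZeroVec F w₁ →
      OnProductLine S T a₁ (0v m) a₂ v₂ p → OnProductLine S T a₁ (0v m) a₂ v₂ q →
      OnProductLine S′ T′ b₁ w₁ b₂ w₂ p → OnProductLine S′ T′ b₁ w₁ b₂ w₂ q → p ≡ q
    vertical∩transversal S S′ T T′ w₁≢0 pL qL pM qM =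
      proj₁-injectiveOnTransversal S′ T′ w₁≢0 pM qM (proj₁-constantOnVertical S T pL qL)

    module _ (S S′ : AGSpace F m P) (T T′ : AGSpace F n Q) where

      productLines-orthogoval : Orthogoval F S S′ → Orthogoval F T T′ →
        ∀ {a₁ v₁ b₁ w₁ a₂ v₂ b₂ w₂ p q r} → NonZeroVec F (v₁ ++ v₂) → NonZeroVec F (w₁ ++ w₂) →
        p ≢ q → p ≢ r → q ≢ r →
        OnProductLine S T a₁ v₁ a₂ v₂ p → OnProductLine S T a₁ v₁ a₂ v₂ q →
        OnProductLine S T a₁ v₁ a₂ v₂ r →
        OnProductLine S′ T′ b₁ w₁ b₂ w₂ p → OnProductLine S′ T′ b₁ w₁ b₂ w₂ q →
        OnProductLine S′ T′ b₁ w₁ b₂ w₂ r → ⊥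
      productLines-orthogoval S⊥S′ T⊥T′ {v₁ = v₁} {w₁ = w₁} {v₂ = v₂} {w₂ = w₂}
        v≢0 w≢0 p≢q p≢r q≢r pL qL rL pM qM rM
        with productDirection v₁ v₂ v≢0 | productDirection w₁ w₂ w≢0
      ... | vertical v₂≢0 | vertical w₂≢0 =
        T⊥T′ _ _ _ _ v₂≢0 w₂≢0 _ _ _
          (p≢q ∘ proj₂-injectiveOnVertical S T pL qL)
          (p≢r ∘ proj₂-injectiveOnVertical S T pL rL)
          (q≢r ∘ proj₂-injectiveOnVertical S T qL rL)
          (onProductLine-proj₂ S T pL) (onProductLine-proj₂ S T qL)
          (onProductLine-proj₂ S T rL) (onProductLine-proj₂ S′ T′ pM)
          (onProductLine-proj₂ S′ T′ qM) (onProductLine-proj₂ S′ T′ rM)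
      ... | vertical _ | transversal w₁≢0 = p≢q (vertical∩transversal S S′ T T′ w₁≢0 pL qL pM qM)
      ... | transversal v₁≢0 | vertical _ = p≢q (vertical∩transversal S′ S T′ T v₁≢0 pM qM pL qL)
      ... | transversal v₁≢0 | transversal w₁≢0 =
        S⊥S′ _ _ _ _ v₁≢0 w₁≢0 _ _ _
          (p≢q ∘ proj₁-injectiveOnTransversal S T v₁≢0 pL qL)
          (p≢r ∘ proj₁-injectiveOnTransversal S T v₁≢0 pL rL)
          (q≢r ∘ proj₁-injectiveOnTransversal S T v₁≢0 qL rL)
          (onProductLine-proj₁ S T pL) (onProductLine-proj₁ S T qL)
          (onProductLine-proj₁ S T rL) (onProductLine-proj₁ S′ T′ pM)
          (onProductLine-proj₁ S′ T′ qM) (onProductLine-proj₁ S′ T′ rM)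

      ⊗-orthogoval : Orthogoval F S S′ → Orthogoval F T T′ → Orthogoval F (S ⊗ T) (S′ ⊗ T′)
      ⊗-orthogoval S⊥S′ T⊥T′ a v b w v≢0 w≢0 p q r p≢q p≢r q≢r pL qL rL pM qM rM
        with splitAt m a | splitAt m v | splitAt m b | splitAt m w
      ... | a₁ , a₂ , refl | v₁ , v₂ , refl | b₁ , b₂ , refl | w₁ , w₂ , refl =
        productLines-orthogoval S⊥S′ T⊥T′ v≢0 w≢0 p≢q p≢r q≢r
          (L pL) (L qL) (L rL) (M pM) (M qM) (M rM)
        where
        L : ∀ {p} → OnLineOf F (S ⊗ T) (a₁ ++ a₂) (v₁ ++ v₂) p → OnProductLine S T a₁ v₁ a₂ v₂ p
        L = onLineOf⇒onProductLine S T a₁ v₁ a₂ v₂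
        M : ∀ {p} → OnLineOf F (S′ ⊗ T′) (b₁ ++ b₂) (w₁ ++ w₂) p → OnProductLine S′ T′ b₁ w₁ b₂ w₂ p
        M = onLineOf⇒onProductLine S′ T′ b₁ w₁ b₂ w₂

      horizontal⊈vertical : ∀ {a₁ v₁ b₁ w₁ : Pt F m} {b₂ w₂ : Pt F n} {y₀ : Q} →
        NonZeroVec F v₁ → w₁ ≡ 0v m →
        ¬ (∀ {x} → OnLineOf F S a₁ v₁ x → OnProductLine S′ T′ b₁ w₁ b₂ w₂ (x , y₀))
      horizontal⊈vertical {a₁} {v₁} v₁≢0 refl ℓ⊆M = 0≢1 (lineAt-injective a₁ v₁ v₁≢0 (begin
        lineAt a₁ v₁ 0#    ≡⟨ strictlyInverseˡ S _ ⟨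
        to S (pointAt 0#)  ≡⟨ cong (to S) pointAt0≡pointAt1 ⟩
        to S (pointAt 1#)  ≡⟨ strictlyInverseˡ S _ ⟩
        lineAt a₁ v₁ 1#    ∎))
        where
        open ≡-Reasoning
        pointAt : Carrier → P
        pointAt t = from S (lineAt a₁ v₁ t)
        pointAt0≡pointAt1 : pointAt 0# ≡ pointAt 1#
        pointAt0≡pointAt1 = proj₁-constantOnVertical S′ T′ (ℓ⊆M (onLineOf-from S a₁ v₁ 0#))
                                                           (ℓ⊆M (onLineOf-from S a₁ v₁ 1#))

      isLineOf-horizontal : ∀ {a₁ v₁ : Pt F m} (y₀ : Q) → NonZeroVec F v₁ →
        IsLineOf (S′ ⊗ T′) (S ⊗ T) (a₁ ++ to T y₀) (v₁ ++ 0v n) → IsLineOf S′ S a₁ v₁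
      isLineOf-horizontal {a₁} {v₁} y₀ v₁≢0 (b , w , _ , L⇔M) with splitAt m b | splitAt m w
      ... | b₁ , b₂ , refl | w₁ , w₂ , refl = b₁ , w₁ , w₁≢0 , λ x → ℓ⇒ℓ′ , ℓ′⇒ℓ
        where
        L⇒M : ∀ {p} → OnProductLine S T a₁ v₁ (to T y₀) (0v n) p → OnProductLine S′ T′ b₁ w₁ b₂ w₂ p
        L⇒M = onLineOf⇒onProductLine S′ T′ b₁ w₁ b₂ w₂ ∘ proj₁ (L⇔M _) ∘ onProductLine⇒onLineOf S T

        M⇒L : ∀ {p} → OnProductLine S′ T′ b₁ w₁ b₂ w₂ p → OnProductLine S T a₁ v₁ (to T y₀) (0v n) p
        M⇒L = onLineOf⇒onProductLine S T a₁ v₁ (to T y₀) (0v n) ∘ proj₂ (L⇔M _)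
            ∘ onProductLine⇒onLineOf S′ T′

        ℓ×y₀⊆L : ∀ {x} → OnLineOf F S a₁ v₁ x → OnProductLine S T a₁ v₁ (to T y₀) (0v n) (x , y₀)
        ℓ×y₀⊆L (t , eq) = onProductLine t eq (sym (lineAt-0v (to T y₀) t))

        w₁≢0 : NonZeroVec F w₁
        w₁≢0 w₁≡0 = horizontal⊈vertical v₁≢0 w₁≡0 (L⇒M ∘ ℓ×y₀⊆L)

        ℓ⇒ℓ′ : ∀ {x} → OnLineOf F S a₁ v₁ x → OnLineOf F S′ b₁ w₁ x
        ℓ⇒ℓ′ = onProductLine-proj₁ S′ T′ ∘ L⇒M ∘ ℓ×y₀⊆L

        ℓ′⇒ℓ : ∀ {x} → OnLineOf F S′ b₁ w₁ x → OnLineOf F S a₁ v₁ x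
        ℓ′⇒ℓ (t , eq) =
          onProductLine-proj₁ S T (M⇒L (onProductLine t eq (strictlyInverseˡ T′ (lineAt b₂ w₂ t))))

      ⊗-reflects-LinesIncluded : LinesIncluded F (S ⊗ T) (S′ ⊗ T′) → LinesIncluded F S S′
      ⊗-reflects-LinesIncluded ST⊆S′T′ a₁ v₁ v₁≢0 =
        isLineOf-horizontal y₀ v₁≢0 (ST⊆S′T′ (a₁ ++ to T y₀) (v₁ ++ 0v n) v₁0≢0)
        where
        y₀ : Q
        y₀ = from T (0v n)
        v₁0≢0 : NonZeroVec F (v₁ ++ 0v n)
        v₁0≢0 eq = v₁≢0 (++-injectiveˡ v₁ (0v m) (trans eq (replicate-++ m n 0#)))

    ⊗-reflects-SameSpace : (S S′ : AGSpace F m P) (T T′ : AGSpace F n Q) →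
      SameSpace F (S ⊗ T) (S′ ⊗ T′) → SameSpace F S S′
    ⊗-reflects-SameSpace S S′ T T′ (ST⊆S′T′ , S′T′⊆ST) =
      ⊗-reflects-LinesIncluded S S′ T T′ ST⊆S′T′ , ⊗-reflects-LinesIncluded S′ S T′ T S′T′⊆ST

    ⊗-mutuallyOrthogoval : ∀ {k m n} → MutuallyOrthogovalSet F k m → MutuallyOrthogovalSet F k n →
      MutuallyOrthogovalSet F k (m + n)
    ⊗-mutuallyOrthogoval (P , S , S-mo) (Q , T , T-mo) =
      (P × Q) , (λ i → S i ⊗ T i) , λ i j i≢j →
        proj₁ (S-mo i j i≢j) ∘ ⊗-reflects-SameSpace (S i) (S j) (T i) (T j) ,
        ⊗-orthogoval (S i) (S j) (T i) (T j) (proj₂ (S-mo i j i≢j)) (proj₂ (T-mo i j i≢j))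

finite⇒decidableEquality : (F : Field) → IsFinite F → DecidableEquality (Field.Carrier F)
finite⇒decidableEquality F (_ , C↔Fin) = inj⇒≟ (↔⇒↣ C↔Fin)

mainTheorem4 : (F : Field) → IsFinite F → (k m n : ℕ) → k ≥ 1 →
    MutuallyOrthogovalSet F k m → MutuallyOrthogovalSet F k n →
    MutuallyOrthogovalSet F k (m + n)
mainTheorem4 F finite k m n _ = ⊗-mutuallyOrthogoval F (finite⇒decidableEquality F finite)
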